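{- For every integer $n\ge 1$, the inversion index of the tournament $C_3.\underline{n}$ is $n$.
   Context: A tournament $T$ has vertex set $V(T)$ and arc set $A(T)$, with exactly one of $(x,y),(y,x)$ in $A(T)$ for every distinct $x,y$. For $X\subseteq V(T)$, $\mathrm{Inv}(T,X)$ is the tournament obtained from $T$ by reversing every arc with both ends in $X$. For a finite sequence $(X_i)_{i<m}$ of subsets, $\mathrm{Inv}(T,(X_i)_{i<m})$ is obtained by successively applying these reversals; equivalently an arc $(x,y)$ is reversed iff the number of $i$ with $\{x,y\}\subseteq X_i$ is odd. The inversion index $i(T)$ is the least integer $m$ such that there is a sequence $(X_i)_{i<m}$ of subsets of $V(T)$ with $\mathrm{Inv}(T,(X_i)_{i<m})$ acyclic (i.e. transitive). $C_3.\underline{n}$ is the lexicographic sum of copies of the $3$-cycle over the acyclic tournament on $0<1<\dots<n-1$: its vertex set is $\{0,1,2\}\times\{0,\dots,n-1\}$, for each $i$ the arcs $((0,i),(1,i)),((1,i),(2,i)),((2,i),(0,i))$ are present, and for $i<j$ every arc $((a,i),(b,j))$ is present. -}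

module Defs where

open import Data.Bool using (Bool; true; false; if_then_else_; _∧_; _∨_)
open import Data.Nat using (ℕ; zero; suc; _<_; _<ᵇ_; _≡ᵇ_)
open import Data.Fin using (Fin; toℕ; zero; suc; _≟_)
open import Data.Product using (_×_; _,_; ∃)
open import Data.Sum using (_⊎_)
open import Data.Vec using (Vec; []; _∷_)
open import Relation.Nullary using (¬_)
open import Relation.Nullary.Decidable using (⌊_⌋)
open import Relation.Binary.PropositionalEquality using (_≡_; _≢_)

Digraph : Set → Set
Digraph V = V → V → Bool

record IsTournament {V : Set} (T : Digraph V) : Set where
  field
    irrefl : ∀ x → T x x ≡ false
    total  : ∀ x y → x ≢ y →
             ((T x y ≡ true) × (T y x ≡ false)) ⊎ ((T x y ≡ false) × (T y x ≡ true))

Subset : Set → Set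
Subset V = V → Bool

Inv : {V : Set} → Digraph V → Subset V → Digraph V
Inv T X x y = if X x ∧ X y then T y x else T x y

InvSeq : {V : Set} {m : ℕ} → Digraph V → Vec (Subset V) m → Digraph V
InvSeq T []       = T
InvSeq T (X ∷ Xs) = InvSeq (Inv T X) Xs

-- Acyclic (= transitive, for tournaments).
IsTransitive : {V : Set} → Digraph V → Set
IsTransitive T = ∀ x y z → T x y ≡ true → T y z ≡ true → T x z ≡ true

InvertibleWith : {V : Set} → Digraph V → ℕ → Set
InvertibleWith {V} T m = ∃ λ (Xs : Vec (Subset V) m) → IsTransitive (InvSeq T Xs)

InversionIndexIs : {V : Set} → Digraph V → ℕ → Set
InversionIndexIs T k = InvertibleWith T k × (∀ m → m < k → ¬ InvertibleWith T m)

next3 : Fin 3 → Fin 3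
next3 zero          = suc zero
next3 (suc zero)    = suc (suc zero)
next3 (suc (suc zero)) = zero

C3Lex : (n : ℕ) → Digraph (Fin 3 × Fin n)
C3Lex n (a , i) (b , j) =
  (toℕ i <ᵇ toℕ j) ∨ ((toℕ i ≡ᵇ toℕ j) ∧ ⌊ b ≟ next3 a ⌋)

-- Record for each vertex which of the inverted sets contain it, as an incidence vector in F₂ᵐ;
-- an arc ends up reversed iff the incidence vectors of its ends have odd inner product.
-- Upper bound: reversing (0,i) → (1,i) in every copy i makes C₃.n transitive.
-- Lower bound: suppose m < n inversions make it transitive, and let t_b be the top vertex of
-- copy b.  The n vectors χ(t_b) are dependent over F₂, say Σ_{b∈D} χ(t_b) = 0 with D ≠ ∅, so
-- Σ_{b∈D} parity(x, t_b) = 0 for every vertex x.  Take a ∈ D with t_a lowest, and x₁, x₂ the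
-- other two vertices of copy a.  For b ≠ a in D, both xᵢ lie below t_a, hence below t_b, and
-- C₃.n treats them alike with respect to t_b, so their parities with t_b agree; at b = a they
-- differ, since exactly one of x₁, x₂ beats t_a in the 3-cycle.  Thus
-- Σ_{b∈D} (parity(x₁, t_b) + parity(x₂, t_b)) = 1, a contradiction.
module Submission where

open import Algebra.Bundles using (CommutativeRing; CommutativeMonoid)
open import Data.Bool using (Bool; true; false; not; _∧_; _xor_; if_then_else_)
open import Data.Bool.Properties
  using ( ∧-comm; ∧-assoc; ∧-zeroʳ; ∧-distribˡ-xor; ∧-distribʳ-xor; xor-same; xor-identityʳ; xor-inverseˡ
        ; xor-annihilates-not; not-involutive; ∨-identityʳ; if-not; if-eta; T-≡; ∧-commutativeMonoid
        ; xor-∧-commutativeRing)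
  renaming (_≟_ to _≟ᴮ_)
open import Data.Fin using (Fin; zero; suc; toℕ; _≟_; punchIn; combine; finToFun; funToFin)
open import Data.Fin.Properties
  using (toℕ-injective; suc-injective; punchInᵢ≢i; pigeonhole; ¬∀⟶∃¬; 2↔Bool
        ; finToFun-funToFin; funToFin-finToFin)
open import Data.Nat using (ℕ; zero; suc; _+_; _*_; _^_; _<_; _≤_; _<ᵇ_; z≤n; s≤s)
open import Data.Nat.Properties using (<-trans; <ᵇ⇒<; <⇒<ᵇ; ^-monoʳ-<; <-irrefl; _<?_)
import Data.Nat.Properties as ℕ
open import Data.Product using (_×_; _,_; ∃; ∃₂; proj₁; proj₂)
open import Data.Sum using (_⊎_; inj₁; inj₂)
open import Data.Vec using (Vec; []; _∷_; lookup; tabulate)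
open import Data.Vec.Properties using (lookup∘tabulate)
open import Function using (_∘_; _on_; flip; const; Inverse; Equivalence)
open import Function.Definitions using (Injective)
open import Relation.Nullary using (¬_; yes; no; does; contradiction)
open import Relation.Nullary.Decidable using (⌊_⌋; dec-true; dec-false)
open import Relation.Binary.PropositionalEquality

open import Defs

open import Algebra.Properties.Semiring.Sum (CommutativeRing.semiring xor-∧-commutativeRing)
  using (sum; sum-syntax; sum-cong-≗; sum-replicate-zero; sum-remove; ∑-distrib-+; ∑-comm
        ; *-distribˡ-sum)
open import Algebra.Properties.CommutativeSemigroup
  (CommutativeMonoid.commutativeSemigroup ∧-commutativeMonoid) using (x∙yz≈y∙xz)

sum-zero : ∀ {n} (f : Fin n → Bool) → (∀ k → f k ≡ false) → sum f ≡ false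
sum-zero {n} f f≡0 = trans (sum-cong-≗ f≡0) (sum-replicate-zero n)

sum-single : ∀ {n} (f : Fin n → Bool) i → (∀ k → k ≢ i → f k ≡ false) → sum f ≡ f i
sum-single {suc n} f i others = begin
  sum f                               ≡⟨ sum-remove {i = i} f ⟩
  f i xor sum (λ k → f (punchIn i k)) ≡⟨ cong (f i xor_) (sum-zero _ (λ k → others _ (punchInᵢ≢i i k))) ⟩
  f i xor false                       ≡⟨ xor-identityʳ (f i) ⟩
  f i                                 ∎
  where open ≡-Reasoning

infix 7 _·_

_·_ : ∀ {m} → (Fin m → Bool) → (Fin m → Bool) → Bool
u · v = ∑[ k < _ ] (u k ∧ v k)

combination : ∀ {m n} → (Fin n → Fin m → Bool) → (Fin n → Bool) → Fin m → Bool
combination {n = n} v D k = ∑[ b < n ] (D b ∧ v b k)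

·-zeroʳ : ∀ {m} (u v : Fin m → Bool) → (∀ k → v k ≡ false) → u · v ≡ false
·-zeroʳ u v v≡0 = sum-zero _ (λ k → trans (cong (u k ∧_) (v≡0 k)) (∧-zeroʳ (u k)))

∑-· : ∀ {m n} (u : Fin m → Bool) (w : Fin n → Fin m → Bool) (D : Fin n → Bool) →
      ∑[ b < n ] (D b ∧ u · w b) ≡ u · combination w D
∑-· {m} {n} u w D = begin
  ∑[ b < n ] (D b ∧ ∑[ k < m ] (u k ∧ w b k))    ≡⟨ sum-cong-≗ (λ b → *-distribˡ-sum (D b) (λ k → u k ∧ w b k)) ⟩
  ∑[ b < n ] ∑[ k < m ] (D b ∧ (u k ∧ w b k))    ≡⟨ ∑-comm (λ b k → D b ∧ (u k ∧ w b k)) ⟩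
  ∑[ k < m ] ∑[ b < n ] (D b ∧ (u k ∧ w b k))    ≡⟨ sum-cong-≗ (λ k → sum-cong-≗ (λ b → x∙yz≈y∙xz (D b) (u k) (w b k))) ⟩
  ∑[ k < m ] ∑[ b < n ] (u k ∧ (D b ∧ w b k))    ≡⟨ sum-cong-≗ (λ k → *-distribˡ-sum (u k) (λ b → D b ∧ w b k)) ⟨
  ∑[ k < m ] (u k ∧ ∑[ b < n ] (D b ∧ w b k))    ∎
  where open ≡-Reasoning

combination-xor : ∀ {m n} (v : Fin n → Fin m → Bool) (S S′ : Fin n → Bool) k →
                  combination v (λ b → S b xor S′ b) k ≡ combination v S k xor combination v S′ k
combination-xor {n = n} v S S′ k = begin
  ∑[ b < n ] ((S b xor S′ b) ∧ v b k)            ≡⟨ sum-cong-≗ (λ b → ∧-distribʳ-xor (v b k) (S b) (S′ b)) ⟩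
  ∑[ b < n ] ((S b ∧ v b k) xor (S′ b ∧ v b k))  ≡⟨ ∑-distrib-+ (λ b → S b ∧ v b k) (λ b → S′ b ∧ v b k) ⟩
  combination v S k xor combination v S′ k       ∎
  where open ≡-Reasoning

xor-≢ : ∀ {x y} → x ≢ y → x xor y ≡ true
xor-≢ {false} {false} x≢y = contradiction refl x≢y
xor-≢ {false} {true}  _   = refl
xor-≢ {true}  {false} _   = refl
xor-≢ {true}  {true}  x≢y = contradiction refl x≢y

∧-false-unless : ∀ {x y} → (x ≡ true → y ≡ false) → x ∧ y ≡ false
∧-false-unless {false} _ = refl
∧-false-unless {true}  y≡false = y≡false refl

module _ where
  open Inverse 2↔Bool using (to; from; strictlyInverseˡ; strictlyInverseʳ)

  toBits : ∀ {n} → Fin (2 ^ n) → Fin n → Bool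
  toBits i = to ∘ finToFun i

  fromBits : ∀ {n} → (Fin n → Bool) → Fin (2 ^ n)
  fromBits u = funToFin (from ∘ u)

  fromBits-injective : ∀ {n} {u v : Fin n → Bool} → fromBits u ≡ fromBits v → ∀ b → u b ≡ v b
  fromBits-injective {u = u} {v} eq b = begin
    u b                                   ≡⟨ strictlyInverseˡ (u b) ⟨
    to (from (u b))                       ≡⟨ cong to (finToFun-funToFin (from ∘ u) b) ⟨
    to (finToFun (fromBits u) b)          ≡⟨ cong (λ i → to (finToFun i b)) eq ⟩
    to (finToFun (fromBits v) b)          ≡⟨ cong to (finToFun-funToFin (from ∘ v) b) ⟩
    to (from (v b))                       ≡⟨ strictlyInverseˡ (v b) ⟩
    v b                                   ∎
    where open ≡-Reasoning

  funToFin-cong : ∀ {m n} {f g : Fin m → Fin n} → (∀ b → f b ≡ g b) → funToFin f ≡ funToFin g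
  funToFin-cong {zero}  _   = refl
  funToFin-cong {suc m} f≗g = cong₂ combine (f≗g zero) (funToFin-cong (f≗g ∘ suc))

  toBits-injective : ∀ {n} {i j : Fin (2 ^ n)} → (∀ b → toBits i b ≡ toBits j b) → i ≡ j
  toBits-injective {n} {i} {j} i≗j = begin
    i                          ≡⟨ funToFin-finToFin {n} {2} i ⟨
    funToFin {n} (finToFun i)  ≡⟨ funToFin-cong {n} (λ b → trans (sym (strictlyInverseʳ (finToFun i b))) (cong from (i≗j b))) ⟩
    fromBits {n} (toBits j)    ≡⟨ funToFin-cong {n} (λ b → strictlyInverseʳ (finToFun j b)) ⟩
    funToFin {n} (finToFun j)  ≡⟨ funToFin-finToFin {n} {2} j ⟩
    j                          ∎
    where open ≡-Reasoning

-- The 2ⁿ coefficient vectors give at most 2ᵐ combinations, so two distinct ones collide.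
linearly-dependent : ∀ {m n} → m < n → (v : Fin n → Fin m → Bool) →
                     ∃₂ λ D b₀ → D b₀ ≡ true × (∀ k → combination v D k ≡ false)
linearly-dependent {m} {n} m<n v
  with i , j , i<j , collide ← pigeonhole (^-monoʳ-< 2 (s≤s (s≤s z≤n)) m<n) (fromBits ∘ combination v ∘ toBits)
  with b₀ , differ ← ¬∀⟶∃¬ n (λ b → toBits i b ≡ toBits j b) (λ b → toBits i b ≟ᴮ toBits j b)
                       (λ i≗j → <-irrefl (cong toℕ (toBits-injective i≗j)) i<j)
  = (λ b → toBits i b xor toBits j b) , b₀ , xor-≢ differ , vanishes
  where
  vanishes : ∀ k → combination v (λ b → toBits i b xor toBits j b) k ≡ false
  vanishes k = begin
    combination v (λ b → toBits i b xor toBits j b) k          ≡⟨ combination-xor v (toBits i) (toBits j) k ⟩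
    combination v (toBits i) k xor combination v (toBits j) k  ≡⟨ cong (_xor _) (fromBits-injective collide k) ⟩
    combination v (toBits j) k xor combination v (toBits j) k  ≡⟨ xor-same (combination v (toBits j) k) ⟩
    false                                                      ∎
    where open ≡-Reasoning

module _ {V : Set} where

  IsTournament-converse : {T : Digraph V} → IsTournament T → ∀ {x y} → x ≢ y → T y x ≡ not (T x y)
  IsTournament-converse tour {x} {y} x≢y with IsTournament.total tour x y x≢y
  ... | inj₁ (Txy , Tyx) = trans Tyx (cong not (sym Txy))
  ... | inj₂ (Txy , Tyx) = trans Tyx (cong not (sym Txy))

  mkTournament : {T : Digraph V} → (∀ x → T x x ≡ false) → (∀ {x y} → x ≢ y → T y x ≡ not (T x y)) → IsTournament T
  mkTournament {T} irrefl converse = record { irrefl = irrefl ; total = total }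
    where
    total : ∀ x y → x ≢ y → ((T x y ≡ true) × (T y x ≡ false)) ⊎ ((T x y ≡ false) × (T y x ≡ true))
    total x y x≢y with T x y in Txy
    ... | true  = inj₁ (refl , trans (converse x≢y) (cong not Txy))
    ... | false = inj₂ (refl , trans (converse x≢y) (cong not Txy))

  Inv-isTournament : {T : Digraph V} → IsTournament T → (X : Subset V) → IsTournament (Inv T X)
  Inv-isTournament {T} tour X = mkTournament irrefl converse
    where
    irrefl : ∀ x → Inv T X x x ≡ false
    irrefl x = trans (if-eta (X x ∧ X x)) (IsTournament.irrefl tour x)
    converse : ∀ {x y} → x ≢ y → Inv T X y x ≡ not (Inv T X x y)
    converse {x} {y} x≢y rewrite ∧-comm (X y) (X x) with X x ∧ X y
    ... | true  = trans (sym (not-involutive _)) (cong not (sym (IsTournament-converse tour x≢y)))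
    ... | false = IsTournament-converse tour x≢y

InvSeq-isTournament : ∀ {V m} {T : Digraph V} → IsTournament T → (Xs : Vec (Subset V) m) →
                      IsTournament (InvSeq T Xs)
InvSeq-isTournament tour []       = tour
InvSeq-isTournament tour (X ∷ Xs) = InvSeq-isTournament (Inv-isTournament tour X) Xs

incidence : ∀ {V m} → Vec (Subset V) m → V → Fin m → Bool
incidence Xs x k = lookup Xs k x

InvSeq-parity : ∀ {V m} (T : Digraph V) (Xs : Vec (Subset V) m) x y →
                InvSeq T Xs x y ≡ (if incidence Xs x · incidence Xs y then T y x else T x y)
InvSeq-parity T []       x y = refl
InvSeq-parity T (X ∷ Xs) x y
  rewrite InvSeq-parity (Inv T X) Xs x y with X x | X y
... | true  | true  = sym (if-not (incidence Xs x · incidence Xs y))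
... | true  | false = refl
... | false | true  = refl
... | false | false = refl

reversal-parity : ∀ {V m} {T : Digraph V} → IsTournament T → (Xs : Vec (Subset V) m) → ∀ {x y} → x ≢ y →
                 incidence Xs x · incidence Xs y ≡ InvSeq T Xs x y xor T x y
reversal-parity {T = T} tour Xs {x} {y} x≢y
  rewrite InvSeq-parity T Xs x y with incidence Xs x · incidence Xs y
... | true  = sym (trans (cong (_xor T x y) (IsTournament-converse tour x≢y)) (xor-inverseˡ (T x y)))
... | false = sym (xor-same (T x y))

module _ {V W : Set} {T : Digraph V} where

  on-isTournament : {f : W → V} → Injective _≡_ _≡_ f → IsTournament T → IsTournament (T on f)
  on-isTournament f-inj tour =
    mkTournament (IsTournament.irrefl tour ∘ _) (λ x≢y → IsTournament-converse tour (x≢y ∘ f-inj))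

  on-isTransitive : (f : W → V) → IsTransitive T → IsTransitive (T on f)
  on-isTransitive f T-trans x y z = T-trans (f x) (f y) (f z)

module _ {V : Set} {T : Digraph V} where

  flip-isTournament : IsTournament T → IsTournament (flip T)
  flip-isTournament tour =
    mkTournament (IsTournament.irrefl tour) (λ x≢y → IsTournament-converse tour (x≢y ∘ sym))

  flip-isTransitive : IsTransitive T → IsTransitive (flip T)
  flip-isTransitive T-trans x y z Tyx Tzy = T-trans z y x Tzy Tyx

IsLeast : ∀ {V} → Digraph V → Subset V → V → Set
IsLeast T D a = D a ≡ true × (∀ b → D b ≡ true → b ≢ a → T a b ≡ true)

module _ {k} {T : Digraph (Fin (suc k))} (D : Subset (Fin (suc k))) where

  zero-isLeast : D zero ≡ true → (∀ b → D (suc b) ≡ true → T zero (suc b) ≡ true) → IsLeast T D zero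
  zero-isLeast D₀ below = D₀ , λ { zero _ 0≢0 → contradiction refl 0≢0 ; (suc b) Db _ → below b Db }

  suc-isLeast : ∀ {a} → IsLeast (T on suc) (D ∘ suc) a → (D zero ≡ true → T (suc a) zero ≡ true) →
                IsLeast T D (suc a)
  suc-isLeast (Da , a-least) above₀ =
    Da , λ { zero D₀ _ → above₀ D₀ ; (suc b) Db b≢a → a-least b Db (b≢a ∘ cong suc) }

least-or-empty : ∀ {k} {T : Digraph (Fin k)} → IsTournament T → IsTransitive T → (D : Subset (Fin k)) →
                 ∃ (IsLeast T D) ⊎ (∀ b → D b ≡ false)
least-or-empty {zero} _ _ _ = inj₂ λ ()
least-or-empty {suc k} {T} tour T-trans D
  with least-or-empty (on-isTournament suc-injective tour) (on-isTransitive suc T-trans) (D ∘ suc) | D zero in D₀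
... | inj₂ none | false = inj₂ λ { zero → D₀ ; (suc b) → none b }
... | inj₂ none | true  = inj₁ (zero , zero-isLeast {T = T} D D₀ (λ b Db → contradiction (trans (sym Db) (none b)) λ ()))
... | inj₁ (a , a-least) | false = inj₁ (suc a , suc-isLeast {T = T} D a-least λ D0 → contradiction (trans (sym D0) D₀) λ ())
... | inj₁ (a , a-least) | true with T zero (suc a) in T₀ₐ
...   | false = inj₁ (suc a , suc-isLeast {T = T} D a-least λ _ →
                             trans (IsTournament-converse tour λ ()) (cong not T₀ₐ))
...   | true  = inj₁ (zero , zero-isLeast {T = T} D D₀ below)
  where
  below : ∀ b → D (suc b) ≡ true → T zero (suc b) ≡ true
  below b Db with b ≟ a
  ... | yes refl = T₀ₐ
  ... | no b≢a   = T-trans _ _ _ T₀ₐ (proj₂ a-least b Db b≢a)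

-- Opaque: unfolding these in conversion checks makes the lower bound very slow to typecheck.
opaque
  least : ∀ {k} {T : Digraph (Fin k)} → IsTournament T → IsTransitive T → (D : Subset (Fin k)) →
          ∀ {b₀} → D b₀ ≡ true → ∃ (IsLeast T D)
  least tour T-trans D {b₀} Db₀ with least-or-empty tour T-trans D
  ... | inj₁ a-least = a-least
  ... | inj₂ none    = contradiction (trans (sym Db₀) (none b₀)) λ ()

  greatest : ∀ {k} {T : Digraph (Fin (suc k))} → IsTournament T → IsTransitive T →
             ∃ λ h → ∀ c → c ≢ h → T c h ≡ true
  greatest tour T-trans with least (flip-isTournament tour) (flip-isTransitive T-trans) (const true) {zero} refl
  ... | h , _ , h-top = h , λ c → h-top c refl

<ᵇ-converse : ∀ m n → m ≢ n → (n <ᵇ m) ≡ not (m <ᵇ n)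
<ᵇ-converse zero    zero    m≢n = contradiction refl m≢n
<ᵇ-converse zero    (suc n) _   = refl
<ᵇ-converse (suc m) zero    _   = refl
<ᵇ-converse (suc m) (suc n) m≢n = <ᵇ-converse m n (m≢n ∘ cong suc)

<ᵇ-+ˡ : ∀ k r s → (k + r <ᵇ k + s) ≡ (r <ᵇ s)
<ᵇ-+ˡ zero    r s = refl
<ᵇ-+ˡ (suc k) r s = <ᵇ-+ˡ k r s

rank-isTransitive : ∀ {V} {T : Digraph V} (h : V → ℕ) → (∀ x y → T x y ≡ (h x <ᵇ h y)) → IsTransitive T
rank-isTransitive {T = T} h T≡< x y z Txy Tyz =
  trans (T≡< x z) (Equivalence.to T-≡ (<⇒<ᵇ (<-trans (rank-< x y Txy) (rank-< y z Tyz))))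
  where
  rank-< : ∀ x y → T x y ≡ true → h x < h y
  rank-< x y Txy = <ᵇ⇒< (h x) (h y) (Equivalence.from T-≡ (trans (sym (T≡< x y)) Txy))

C3 : Digraph (Fin 3)
C3 a b = ⌊ b ≟ next3 a ⌋

C3-isTournament : IsTournament C3
C3-isTournament = mkTournament irrefl converse
  where
  irrefl : ∀ a → C3 a a ≡ false
  irrefl zero             = refl
  irrefl (suc zero)       = refl
  irrefl (suc (suc zero)) = refl
  converse : ∀ {a b} → a ≢ b → C3 b a ≡ not (C3 a b)
  converse {zero}             {zero}             a≢b = contradiction refl a≢b
  converse {zero}             {suc zero}         _   = refl
  converse {zero}             {suc (suc zero)}   _   = refl
  converse {suc zero}         {zero}             _   = refl
  converse {suc zero}         {suc zero}         a≢b = contradiction refl a≢b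
  converse {suc zero}         {suc (suc zero)}   _   = refl
  converse {suc (suc zero)}   {zero}             _   = refl
  converse {suc (suc zero)}   {suc zero}         _   = refl
  converse {suc (suc zero)}   {suc (suc zero)}   a≢b = contradiction refl a≢b

C3Lex-within : ∀ {n} a b (i : Fin n) → C3Lex n (a , i) (b , i) ≡ C3 a b
C3Lex-within a b i
  rewrite dec-false (toℕ i <? toℕ i) (<-irrefl refl) | dec-true (toℕ i ℕ.≟ toℕ i) refl = refl

C3Lex-across : ∀ {n} a b {i j : Fin n} → i ≢ j → C3Lex n (a , i) (b , j) ≡ (toℕ i <ᵇ toℕ j)
C3Lex-across a b {i} {j} i≢j
  rewrite dec-false (toℕ i ℕ.≟ toℕ j) (i≢j ∘ toℕ-injective) = ∨-identityʳ (toℕ i <ᵇ toℕ j)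

C3Lex-isTournament : ∀ {n} → IsTournament (C3Lex n)
C3Lex-isTournament = mkTournament irrefl converse
  where
  irrefl : ∀ x → C3Lex _ x x ≡ false
  irrefl (a , i) = trans (C3Lex-within a a i) (IsTournament.irrefl C3-isTournament a)
  converse : ∀ {x y} → x ≢ y → C3Lex _ y x ≡ not (C3Lex _ x y)
  converse {a , i} {b , j} x≢y with i ≟ j
  ... | yes refl rewrite C3Lex-within a b i | C3Lex-within b a i =
    IsTournament-converse C3-isTournament (x≢y ∘ cong (_, i))
  ... | no i≢j = begin
    C3Lex _ (b , j) (a , i)   ≡⟨ C3Lex-across b a (i≢j ∘ sym) ⟩
    toℕ j <ᵇ toℕ i            ≡⟨ <ᵇ-converse (toℕ i) (toℕ j) (i≢j ∘ toℕ-injective) ⟩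
    not (toℕ i <ᵇ toℕ j)      ≡⟨ cong not (C3Lex-across a b i≢j) ⟨
    not (C3Lex _ (a , i) (b , j)) ∎
    where open ≡-Reasoning

inPair : Fin 3 → Bool
inPair zero             = true
inPair (suc zero)       = true
inPair (suc (suc zero)) = false

-- Position of each vertex of the 3-cycle once its arc 0 → 1 is reversed: 1 < 2 < 0.
rank : Fin 3 → ℕ
rank zero             = 2
rank (suc zero)       = 0
rank (suc (suc zero)) = 1

reversedC3-rank : ∀ a b → (if inPair a ∧ inPair b then C3 b a else C3 a b) ≡ (rank a <ᵇ rank b)
reversedC3-rank zero             zero             = refl
reversedC3-rank zero             (suc zero)       = refl
reversedC3-rank zero             (suc (suc zero)) = refl
reversedC3-rank (suc zero)       zero             = refl
reversedC3-rank (suc zero)       (suc zero)       = refl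
reversedC3-rank (suc zero)       (suc (suc zero)) = refl
reversedC3-rank (suc (suc zero)) zero             = refl
reversedC3-rank (suc (suc zero)) (suc zero)       = refl
reversedC3-rank (suc (suc zero)) (suc (suc zero)) = refl

height : ∀ {n} → Fin 3 × Fin n → ℕ
height (a , i) = toℕ i * 3 + rank a

height-<ᵇ-across : ∀ m n a b → m ≢ n → (m * 3 + rank a <ᵇ n * 3 + rank b) ≡ (m <ᵇ n)
height-<ᵇ-across zero    zero    _                _                m≢n = contradiction refl m≢n
height-<ᵇ-across zero    (suc n) zero             _                _   = refl
height-<ᵇ-across zero    (suc n) (suc zero)       _                _   = refl
height-<ᵇ-across zero    (suc n) (suc (suc zero)) _                _   = refl
height-<ᵇ-across (suc m) zero    _                zero             _   = refl
height-<ᵇ-across (suc m) zero    _                (suc zero)       _   = refl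
height-<ᵇ-across (suc m) zero    _                (suc (suc zero)) _   = refl
height-<ᵇ-across (suc m) (suc n) a                b                m≢n = height-<ᵇ-across m n a b (m≢n ∘ cong suc)

layerPair : ∀ {n} → Fin n → Subset (Fin 3 × Fin n)
layerPair k (a , i) = does (i ≟ k) ∧ inPair a

layerPairs : ∀ n → Vec (Subset (Fin 3 × Fin n)) n
layerPairs n = tabulate layerPair

layerPairs-incidence : ∀ {n} a (i k : Fin n) → incidence (layerPairs n) (a , i) k ≡ does (i ≟ k) ∧ inPair a
layerPairs-incidence a i k = cong-app (lookup∘tabulate layerPair k) (a , i)

layerPairs-parity : ∀ {n} a b (i j : Fin n) →
                    incidence (layerPairs n) (a , i) · incidence (layerPairs n) (b , j) ≡ does (i ≟ j) ∧ (inPair a ∧ inPair b)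
layerPairs-parity {n} a b i j = begin
  ∑[ k < n ] (χ (a , i) k ∧ χ (b , j) k)                ≡⟨ sum-single _ j outside ⟩
  χ (a , i) j ∧ χ (b , j) j                             ≡⟨ cong₂ _∧_ (layerPairs-incidence a i j) (layerPairs-incidence b j j) ⟩
  (does (i ≟ j) ∧ inPair a) ∧ (does (j ≟ j) ∧ inPair b) ≡⟨ cong (λ d → (does (i ≟ j) ∧ inPair a) ∧ (d ∧ inPair b)) (dec-true (j ≟ j) refl) ⟩
  (does (i ≟ j) ∧ inPair a) ∧ inPair b                  ≡⟨ ∧-assoc (does (i ≟ j)) (inPair a) (inPair b) ⟩
  does (i ≟ j) ∧ (inPair a ∧ inPair b)                  ∎
  where
  open ≡-Reasoning
  χ = incidence (layerPairs n)
  outside : ∀ k → k ≢ j → χ (a , i) k ∧ χ (b , j) k ≡ false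
  outside k k≢j = begin
    χ (a , i) k ∧ χ (b , j) k                ≡⟨ cong (χ (a , i) k ∧_) (layerPairs-incidence b j k) ⟩
    χ (a , i) k ∧ (does (j ≟ k) ∧ inPair b)  ≡⟨ cong (λ d → χ (a , i) k ∧ (d ∧ inPair b)) (dec-false (j ≟ k) (k≢j ∘ sym)) ⟩
    χ (a , i) k ∧ false                      ≡⟨ ∧-zeroʳ (χ (a , i) k) ⟩
    false                                    ∎

layerPairs-height : ∀ {n} (x y : Fin 3 × Fin n) → InvSeq (C3Lex n) (layerPairs n) x y ≡ (height x <ᵇ height y)
layerPairs-height {n} (a , i) (b , j)
  rewrite InvSeq-parity (C3Lex n) (layerPairs n) (a , i) (b , j) | layerPairs-parity a b i j with i ≟ j
... | yes refl rewrite C3Lex-within a b i | C3Lex-within b a i | <ᵇ-+ˡ (toℕ i * 3) (rank a) (rank b) =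
  reversedC3-rank a b
... | no i≢j = trans (C3Lex-across a b i≢j) (sym (height-<ᵇ-across (toℕ i) (toℕ j) a b (i≢j ∘ toℕ-injective)))

layerPairs-isTransitive : ∀ n → IsTransitive (InvSeq (C3Lex n) (layerPairs n))
layerPairs-isTransitive n = rank-isTransitive height layerPairs-height

next3-≢ : ∀ h → next3 h ≢ h
next3-≢ zero             ()
next3-≢ (suc zero)       ()
next3-≢ (suc (suc zero)) ()

next3²-≢ : ∀ h → next3 (next3 h) ≢ h
next3²-≢ zero             ()
next3²-≢ (suc zero)       ()
next3²-≢ (suc (suc zero)) ()

C3-exactlyOneInto : ∀ h → C3 (next3 h) h xor C3 (next3 (next3 h)) h ≡ true
C3-exactlyOneInto zero             = refl
C3-exactlyOneInto (suc zero)       = refl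
C3-exactlyOneInto (suc (suc zero)) = refl

module LowerBound {n m} (Xs : Vec (Subset (Fin 3 × Fin n)) m)
                  (F-trans : IsTransitive (InvSeq (C3Lex n) Xs)) where

  F : Digraph (Fin 3 × Fin n)
  F = InvSeq (C3Lex n) Xs

  F-tournament : IsTournament F
  F-tournament = InvSeq-isTournament C3Lex-isTournament Xs

  χ : Fin 3 × Fin n → Fin m → Bool
  χ = incidence Xs

  layerTop : ∀ b → ∃ λ h → ∀ c → c ≢ h → F (c , b) (h , b) ≡ true
  layerTop b = greatest (on-isTournament (cong proj₁) F-tournament) (on-isTransitive (_, b) F-trans)

  top : Fin n → Fin 3
  top b = proj₁ (layerTop b)

  top-greatest : ∀ {b} c → c ≢ top b → F (c , b) (top b , b) ≡ true
  top-greatest {b} = proj₂ (layerTop b)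

  t : Fin n → Fin 3 × Fin n
  t b = top b , b

  reversal-into-top : ∀ {a} c → c ≢ top a → χ (c , a) · χ (t a) ≡ not (C3 c (top a))
  reversal-into-top {a} c c≢top = begin
    χ (c , a) · χ (t a)                       ≡⟨ reversal-parity C3Lex-isTournament Xs (c≢top ∘ cong proj₁) ⟩
    F (c , a) (t a) xor C3Lex n (c , a) (t a) ≡⟨ cong₂ _xor_ (top-greatest c c≢top) (C3Lex-within c (top a) a) ⟩
    not (C3 c (top a))                        ∎
    where open ≡-Reasoning

  reversal-beyond-top : ∀ {a b} c → c ≢ top a → a ≢ b → F (t a) (t b) ≡ true →
                        χ (c , a) · χ (t b) ≡ not (toℕ a <ᵇ toℕ b)
  reversal-beyond-top {a} {b} c c≢top a≢b above = begin
    χ (c , a) · χ (t b)                       ≡⟨ reversal-parity C3Lex-isTournament Xs (a≢b ∘ cong proj₂) ⟩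
    F (c , a) (t b) xor C3Lex n (c , a) (t b) ≡⟨ cong₂ _xor_ (F-trans _ _ _ (top-greatest c c≢top) above) (C3Lex-across c (top b) a≢b) ⟩
    not (toℕ a <ᵇ toℕ b)                      ∎
    where open ≡-Reasoning

  tops-independent : (D : Fin n → Bool) → ∀ {b₀} → D b₀ ≡ true → ¬ (∀ k → combination (χ ∘ t) D k ≡ false)
  tops-independent D Db₀ vanishes = contradiction (trans (sym odd) even) λ ()
    where
    open ≡-Reasoning
    a-least : ∃ (IsLeast (F on t) D)
    a-least = least (on-isTournament {f = t} (cong proj₂) F-tournament) (on-isTransitive t F-trans) D Db₀
    a : Fin n
    a = proj₁ a-least
    h : Fin 3
    h = top a
    x₁ x₂ : Fin 3 × Fin n
    x₁ = next3 h , a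
    x₂ = next3 (next3 h) , a

    orthogonal : ∀ r → ∑[ b < n ] (D b ∧ χ r · χ (t b)) ≡ false
    orthogonal r = trans (∑-· (χ r) (χ ∘ t) D) (·-zeroʳ (χ r) (combination (χ ∘ t) D) vanishes)

    even : ∑[ b < n ] (D b ∧ (χ x₁ · χ (t b) xor χ x₂ · χ (t b))) ≡ false
    even = begin
      ∑[ b < n ] (D b ∧ (χ x₁ · χ (t b) xor χ x₂ · χ (t b)))
        ≡⟨ sum-cong-≗ (λ b → ∧-distribˡ-xor (D b) (χ x₁ · χ (t b)) (χ x₂ · χ (t b))) ⟩
      ∑[ b < n ] ((D b ∧ χ x₁ · χ (t b)) xor (D b ∧ χ x₂ · χ (t b)))
        ≡⟨ ∑-distrib-+ (λ b → D b ∧ χ x₁ · χ (t b)) (λ b → D b ∧ χ x₂ · χ (t b)) ⟩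
      ∑[ b < n ] (D b ∧ χ x₁ · χ (t b)) xor ∑[ b < n ] (D b ∧ χ x₂ · χ (t b))
        ≡⟨ cong₂ _xor_ (orthogonal x₁) (orthogonal x₂) ⟩
      false
        ∎

    beyond : ∀ b → b ≢ a → D b ∧ (χ x₁ · χ (t b) xor χ x₂ · χ (t b)) ≡ false
    beyond b b≢a = ∧-false-unless λ Db →
      let a≢b = b≢a ∘ sym
          above = proj₂ (proj₂ a-least) b Db b≢a
      in trans (cong₂ _xor_ (reversal-beyond-top (next3 h) (next3-≢ h) a≢b above)
                            (reversal-beyond-top (next3 (next3 h)) (next3²-≢ h) a≢b above))
               (xor-same (not (toℕ a <ᵇ toℕ b)))

    odd : ∑[ b < n ] (D b ∧ (χ x₁ · χ (t b) xor χ x₂ · χ (t b))) ≡ true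
    odd = begin
      ∑[ b < n ] (D b ∧ (χ x₁ · χ (t b) xor χ x₂ · χ (t b)))
        ≡⟨ sum-single (λ b → D b ∧ (χ x₁ · χ (t b) xor χ x₂ · χ (t b))) a beyond ⟩
      D a ∧ (χ x₁ · χ (t a) xor χ x₂ · χ (t a))
        ≡⟨ cong₂ _∧_ (proj₁ (proj₂ a-least))
                     (cong₂ _xor_ (reversal-into-top _ (next3-≢ h)) (reversal-into-top _ (next3²-≢ h))) ⟩
      not (C3 (next3 h) h) xor not (C3 (next3 (next3 h)) h)
        ≡⟨ xor-annihilates-not (C3 (next3 h) h) (C3 (next3 (next3 h)) h) ⟩
      C3 (next3 h) h xor C3 (next3 (next3 h)) h
        ≡⟨ C3-exactlyOneInto h ⟩
      true
        ∎

lower-bound : ∀ {n m} → m < n → ¬ InvertibleWith (C3Lex n) m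
lower-bound m<n (Xs , F-trans) =
  let D , _ , Db₀ , vanishes = linearly-dependent m<n (χ ∘ t) in tops-independent D Db₀ vanishes
  where open LowerBound Xs F-trans

mainTheorem2 : (n : ℕ) → 1 ≤ n → InversionIndexIs (C3Lex n) n
mainTheorem2 n _ = (layerPairs n , layerPairs-isTransitive n) , λ m m<n → lower-bound m<n
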